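{- Let $n\ge 1$ and $A\subseteq[n]$. Then the domain $D_{[n]}(A)$ is a copious peak-pit maximal Condorcet domain.
   Context: The set of alternatives is $[n]=\{1,\dots,n\}$, with its natural order as societal axis. For a triple $i<j<k$, the never condition $1N3$ on a set of linear orders means that in every order, $i$ is not ranked last among $i,j,k$; $3N1$ means that $k$ is not ranked first among $i,j,k$. For $A\subseteq[n]$, the set-alternating scheme generated by $A$ assigns to each triple $i<j<k$ the condition $1N3$ if $j\in A$ and $3N1$ if $j\notin A$; $D_{[n]}(A)$ is the set of all linear orders on $[n]$ satisfying all assigned conditions. A domain (set of linear orders on $[n]$) is a Condorcet domain if for every profile with an odd number of voters whose preferences lie in the domain, the pairwise majority relation is transitive. A Condorcet domain $D$ is maximal if every Condorcet domain $D'\supseteq D$ on the same set of alternatives equals $D$. A domain is copious if its restriction to every triple of alternatives consists of exactly 4 distinct orders. A domain is peak-pit if for each triple of alternatives $a<b<c$ its restriction to the triple is either single-peaked (some element of the triple is never ranked last among the three) or single-dipped (some element of the triple is never ranked first among the three). -}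

module Defs where

open import Data.Nat using (ℕ; zero; suc; _*_; _≤_) renaming (_<_ to _<ℕ_)
open import Data.Fin using (Fin; _<_; _<?_)
open import Data.Fin.Permutation using (Permutation′; _⟨$⟩ʳ_)
open import Data.Fin.Subset using (Subset; _∈_; _∉_)
open import Data.List using (List; []; _∷_; length)
open import Data.List.Relation.Unary.All using (All)
open import Data.List.Relation.Unary.Unique.Propositional using (Unique)
open import Data.List.Membership.Propositional using () renaming (_∈_ to _∈L_)
open import Data.Bool using (Bool; true; false)
open import Data.Product using (Σ; ∃; ∃-syntax; _×_; _,_)
open import Data.Sum using (_⊎_)
open import Relation.Nullary using (¬_; yes; no; does)
open import Relation.Binary.PropositionalEquality using (_≡_)

-- A linear order on [n] = Fin n, given by its rank function (a bijection
-- Fin n → Fin n); rank 0 is the most preferred alternative.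
LinOrd : ℕ → Set
LinOrd n = Permutation′ n

rank : ∀ {n} → LinOrd n → Fin n → Fin n
rank v x = v ⟨$⟩ʳ x

_≻[_]_ : ∀ {n} → Fin n → LinOrd n → Fin n → Set
x ≻[ v ] y = rank v x < rank v y

prefB : ∀ {n} → LinOrd n → Fin n → Fin n → Bool
prefB v x y = does (rank v x <? rank v y)

Domain : ℕ → Set₁
Domain n = LinOrd n → Set

Profile : ℕ → Set
Profile n = List (LinOrd n)

Odd : ℕ → Set
Odd m = ∃[ k ] m ≡ suc (2 * k)

votes : ∀ {n} → Fin n → Fin n → Profile n → ℕ
votes x y [] = 0
votes x y (v ∷ P) with prefB v x y
... | true  = suc (votes x y P)
... | false = votes x y P

Maj : ∀ {n} → Profile n → Fin n → Fin n → Set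
Maj P x y = votes y x P <ℕ votes x y P

MajTransitive : ∀ {n} → Profile n → Set
MajTransitive {n} P = ∀ (x y z : Fin n) → Maj P x y → Maj P y z → Maj P x z

IsCondorcet : ∀ {n} → Domain n → Set
IsCondorcet {n} D = ∀ (P : Profile n) → Odd (length P) → All D P → MajTransitive P

IsMaximalCondorcet : ∀ {n} → Domain n → Set₁
IsMaximalCondorcet {n} D =
  IsCondorcet D ×
  (∀ (D' : Domain n) → IsCondorcet D' → (∀ v → D v → D' v) → ∀ v → D' v → D v)

N13 : ∀ {n} → LinOrd n → Fin n → Fin n → Fin n → Set
N13 v i j k = ¬ (j ≻[ v ] i × k ≻[ v ] i)

N31 : ∀ {n} → LinOrd n → Fin n → Fin n → Fin n → Set
N31 v i j k = ¬ (k ≻[ v ] i × k ≻[ v ] j)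

SetAltDomain : ∀ {n} → Subset n → Domain n
SetAltDomain {n} A v = ∀ (i j k : Fin n) → i < j → j < k →
  (j ∈ A → N13 v i j k) × (j ∉ A → N31 v i j k)

-- Restriction of a linear order to the triple a < b < c, recorded as the
-- induced relation on the triple, i.e. its three pairwise comparisons
-- (a above b, a above c, b above c); this determines the restricted order.
Restr : Set
Restr = Bool × Bool × Bool

restrict : ∀ {n} → LinOrd n → Fin n → Fin n → Fin n → Restr
restrict v a b c = prefB v a b , prefB v a c , prefB v b c

Copious : ∀ {n} → Domain n → Set
Copious {n} D = ∀ (a b c : Fin n) → a < b → b < c →
  Σ (List Restr) λ rs → length rs ≡ 4 × Unique rs ×
    All (λ r → ∃[ v ] (D v × restrict v a b c ≡ r)) rs ×
    (∀ v → D v → restrict v a b c ∈L rs)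

InTriple : ∀ {n} → Fin n → Fin n → Fin n → Fin n → Set
InTriple a b c e = e ≡ a ⊎ e ≡ b ⊎ e ≡ c

RankedLast : ∀ {n} → LinOrd n → Fin n → Fin n → Fin n → Fin n → Set
RankedLast v a b c e = ∀ f → InTriple a b c f → ¬ f ≡ e → f ≻[ v ] e

RankedFirst : ∀ {n} → LinOrd n → Fin n → Fin n → Fin n → Fin n → Set
RankedFirst v a b c e = ∀ f → InTriple a b c f → ¬ f ≡ e → e ≻[ v ] f

SinglePeakedOn : ∀ {n} → Domain n → Fin n → Fin n → Fin n → Set
SinglePeakedOn D a b c = ∃[ e ] (InTriple a b c e × (∀ v → D v → ¬ RankedLast v a b c e))

SingleDippedOn : ∀ {n} → Domain n → Fin n → Fin n → Fin n → Set
SingleDippedOn D a b c = ∃[ e ] (InTriple a b c e × (∀ v → D v → ¬ RankedFirst v a b c e))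

PeakPit : ∀ {n} → Domain n → Set
PeakPit {n} D = ∀ (a b c : Fin n) → a < b → b < c →
  SinglePeakedOn D a b c ⊎ SingleDippedOn D a b c

{-# OPTIONS --safe #-}
-- For a triple i < j < k the conditions of D(A) forbid exactly two of its six orders: those
-- ranking i last when j ∈ A, those ranking k first when j ∉ A.  Each of the two cyclic classes
-- {ijk, jki, kij} and {ikj, kji, jik} contains a forbidden order x ≻ y ≻ z, so no voter supports
-- both majorities x > y and y > z, and a majority cycle cannot arise.  Each of the four permitted
-- orders of the triple is realised in D(A) by an order that lists a suitable "early" set first and
-- everything else afterwards, both parts in axis order.  This gives copiousness, and it gives
-- maximality: an order violating a condition on some triple forms, together with two realised
-- orders, a cyclic Latin square on that triple, whose three-voter profile has a cyclic majority.
module Submission where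

open import Defs
open import Data.Bool using (true; false)
open import Data.Bool.Properties using (T-≡)
open import Data.Empty using (⊥; ⊥-elim)
open import Data.Fin using (Fin; toℕ; fromℕ<; _<_; punchOut)
import Data.Fin.Properties as Finₚ
open import Data.Fin.Permutation using (permutation; id)
open import Data.Fin.Subset using (Subset; _∈_; _∉_; _⊂_; ∣_∣) renaming (⊤ to ⊤ˢ)
open import Data.Fin.Subset.Properties using (_∈?_; ∈⊤; p⊂q⇒∣p∣<∣q∣; ∣⊤∣≡n)
open import Data.List using (List; []; _∷_; length; map)
open import Data.List.Relation.Unary.All as All using (All; []; _∷_)
open import Data.List.Relation.Unary.All.Properties using (map⁺)
open import Data.List.Relation.Unary.AllPairs using ([]; _∷_)
open import Data.List.Relation.Unary.Any using (here; there)
open import Data.List.Relation.Unary.Unique.Propositional using (Unique)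
open import Data.List.Membership.Propositional using () renaming (_∈_ to _∈ₗ_)
open import Data.List.Membership.Propositional.Properties using (∈-map⁺)
open import Data.Nat as ℕ using (ℕ; _+_; _*_; _≤_; s≤s; z≤n)
import Data.Nat.Properties as ℕₚ
open import Data.Product using (Σ; ∃-syntax; _×_; _,_; proj₁; proj₂)
open import Data.Sum using (_⊎_; inj₁; inj₂)
open import Data.Unit using (⊤; tt)
open import Data.Vec using (tabulate)
open import Data.Vec.Properties using (lookup∘tabulate; lookup⇒[]=; []=⇒lookup)
open import Function.Bundles using (Injection; Equivalence)
open import Function.Properties.Inverse using (↔⇒↣)
open import Relation.Binary using (tri<; tri≈; tri>)
open import Relation.Binary.PropositionalEquality
  using (_≡_; _≢_; refl; sym; trans; cong; subst; subst₂; module ≡-Reasoning)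
open import Relation.Nullary using (¬_; Dec; yes; no)
open import Relation.Nullary.Decidable using (dec-true; dec-false; _⊎-dec_; _×-dec_; ¬?)
open import Relation.Unary using (Decidable)

private variable
  n : ℕ

module _ (v : LinOrd n) where

  rank-injective : ∀ {x y} → rank v x ≡ rank v y → x ≡ y
  rank-injective = Injection.injective (↔⇒↣ v)

  ≻-trans : ∀ {x y z} → x ≻[ v ] y → y ≻[ v ] z → x ≻[ v ] z
  ≻-trans = Finₚ.<-trans

  ≻-asym : ∀ {x y} → x ≻[ v ] y → ¬ y ≻[ v ] x
  ≻-asym = Finₚ.<-asym

  ≻-total : ∀ {x y} → x ≢ y → x ≻[ v ] y ⊎ y ≻[ v ] x
  ≻-total {x} {y} x≢y with Finₚ.<-cmp (rank v x) (rank v y)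
  ... | tri< x≻y _ _ = inj₁ x≻y
  ... | tri≈ _ eq _ = ⊥-elim (x≢y (rank-injective eq))
  ... | tri> _ _ y≻x = inj₂ y≻x

  prefB-≻ : ∀ {x y} → x ≻[ v ] y → prefB v x y ≡ true
  prefB-≻ {x} {y} = dec-true (rank v x Finₚ.<? rank v y)

  prefB-≺ : ∀ {x y} → y ≻[ v ] x → prefB v x y ≡ false
  prefB-≺ {x} {y} y≻x = dec-false (rank v x Finₚ.<? rank v y) (≻-asym y≻x)

Chain : LinOrd n → Fin n → Fin n → Fin n → Set
Chain v x y z = x ≻[ v ] y × y ≻[ v ] z

<⇒≢ : ∀ {x y : Fin n} → x < y → x ≢ y
<⇒≢ x<y refl = ℕₚ.<-irrefl refl x<y

>⇒≢ : ∀ {x y : Fin n} → y < x → x ≢ y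
>⇒≢ y<x refl = ℕₚ.<-irrefl refl y<x

-- Constructing linear orders

injective⇒surjective : (f : Fin n → Fin n) → (∀ {x y} → f x ≡ f y → x ≡ y) →
                       ∀ y → ∃[ x ] f x ≡ y
injective⇒surjective {ℕ.suc m} f f-injective y with Finₚ.any? (λ x → f x Finₚ.≟ y)
... | yes hit = hit
... | no miss = ⊥-elim (ℕₚ.<-irrefl refl (Finₚ.injective⇒≤ squeeze-injective))
  where
  y≢f : ∀ x → y ≢ f x
  y≢f x eq = miss (x , sym eq)
  squeeze : Fin (ℕ.suc m) → Fin m
  squeeze x = punchOut (y≢f x)
  squeeze-injective : ∀ {x z} → squeeze x ≡ squeeze z → x ≡ z
  squeeze-injective eq = f-injective (Finₚ.punchOut-injective (y≢f _) (y≢f _) eq)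

fromInjection : (f : Fin n → Fin n) → (∀ {x y} → f x ≡ f y → x ≡ y) → LinOrd n
fromInjection f f-injective =
  permutation f (λ y → proj₁ (onto y)) (λ y → proj₂ (onto y)) (λ x → f-injective (proj₂ (onto (f x))))
  where
  onto : ∀ y → ∃[ x ] f x ≡ y
  onto = injective⇒surjective f f-injective

module SortByKey (h : Fin n → ℕ) (h-injective : ∀ {x y} → h x ≡ h y → x ≡ y) where

  below : Fin n → Subset n
  below x = tabulate λ y → h y ℕ.<ᵇ h x

  ∈-below⁺ : ∀ {x y} → h y ℕ.< h x → y ∈ below x
  ∈-below⁺ {x} {y} lt =
    lookup⇒[]= y _ (trans (lookup∘tabulate _ y) (Equivalence.to T-≡ (ℕₚ.<⇒<ᵇ lt)))

  ∈-below⁻ : ∀ {x y} → y ∈ below x → h y ℕ.< h x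
  ∈-below⁻ {x} {y} y∈ =
    ℕₚ.<ᵇ⇒< _ _ (Equivalence.from T-≡ (trans (sym (lookup∘tabulate _ y)) ([]=⇒lookup y∈)))

  below-⊂ : ∀ {x y} → h x ℕ.< h y → below x ⊂ below y
  below-⊂ lt = (λ z∈ → ∈-below⁺ (ℕₚ.<-trans (∈-below⁻ z∈) lt)) ,
               _ , ∈-below⁺ lt , λ x∈ → ℕₚ.<-irrefl refl (∈-below⁻ x∈)

  below-⊂-⊤ : ∀ x → below x ⊂ ⊤ˢ
  below-⊂-⊤ x = (λ _ → ∈⊤) , x , ∈⊤ , λ x∈ → ℕₚ.<-irrefl refl (∈-below⁻ x∈)

  position : Fin n → Fin n
  position x = fromℕ< (subst (∣ below x ∣ ℕ.<_) (∣⊤∣≡n n) (p⊂q⇒∣p∣<∣q∣ (below-⊂-⊤ x)))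

  position-mono : ∀ {x y} → h x ℕ.< h y → position x < position y
  position-mono lt =
    subst₂ ℕ._<_ (sym (Finₚ.toℕ-fromℕ< _)) (sym (Finₚ.toℕ-fromℕ< _)) (p⊂q⇒∣p∣<∣q∣ (below-⊂ lt))

  position-injective : ∀ {x y} → position x ≡ position y → x ≡ y
  position-injective {x} {y} eq with ℕₚ.<-cmp (h x) (h y)
  ... | tri< lt _ _ = ⊥-elim (Finₚ.<-irrefl eq (position-mono lt))
  ... | tri≈ _ same _ = h-injective same
  ... | tri> _ _ gt = ⊥-elim (Finₚ.<-irrefl (sym eq) (position-mono gt))

  sortByKey : LinOrd n
  sortByKey = fromInjection position position-injective

  sortByKey-≻ : ∀ {x y} → h x ℕ.< h y → x ≻[ sortByKey ] y
  sortByKey-≻ = position-mono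

module EarlyFirst {E : Fin n → Set} (E? : Decidable E) where

  shift : ∀ {x} → Dec (E x) → ℕ
  shift {x} (yes _) = toℕ x
  shift {x} (no _) = n + toℕ x

  key : Fin n → ℕ
  key x = shift (E? x)

  late-above-early : (x y : Fin n) → toℕ x ℕ.< n + toℕ y
  late-above-early x y = ℕₚ.<-≤-trans (Finₚ.toℕ<n x) (ℕₚ.m≤m+n n (toℕ y))

  key-injective : ∀ {x y} → key x ≡ key y → x ≡ y
  key-injective {x} {y} = injective (E? x) (E? y)
    where
    injective : (dx : Dec (E x)) (dy : Dec (E y)) → shift dx ≡ shift dy → x ≡ y
    injective (yes _) (yes _) eq = Finₚ.toℕ-injective eq
    injective (no _) (no _) eq = Finₚ.toℕ-injective (ℕₚ.+-cancelˡ-≡ n _ _ eq)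
    injective (yes _) (no _) eq = ⊥-elim (ℕₚ.<-irrefl eq (late-above-early x y))
    injective (no _) (yes _) eq = ⊥-elim (ℕₚ.<-irrefl (sym eq) (late-above-early y x))

  key-early-late : ∀ {x y} → E x → ¬ E y → key x ℕ.< key y
  key-early-late {x} {y} ex ¬ey = lt (E? x) (E? y)
    where
    lt : (dx : Dec (E x)) (dy : Dec (E y)) → shift dx ℕ.< shift dy
    lt (yes _) (no _) = late-above-early x y
    lt (no ¬ex) _ = ⊥-elim (¬ex ex)
    lt (yes _) (yes ey) = ⊥-elim (¬ey ey)

  key-mono : ∀ {x y} → x < y → ¬ (E y × ¬ E x) → key x ℕ.< key y
  key-mono {x} {y} x<y no-inversion = lt (E? x) (E? y)
    where
    lt : (dx : Dec (E x)) (dy : Dec (E y)) → shift dx ℕ.< shift dy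
    lt (yes _) (yes _) = x<y
    lt (no _) (no _) = ℕₚ.+-monoʳ-< n x<y
    lt (yes _) (no _) = late-above-early x y
    lt (no ¬ex) (yes ey) = ⊥-elim (no-inversion (ey , ¬ex))

  open SortByKey key key-injective using (sortByKey-≻)

  earlyFirst : LinOrd n
  earlyFirst = SortByKey.sortByKey key key-injective

  early-≻-late : ∀ {x y} → E x → ¬ E y → x ≻[ earlyFirst ] y
  early-≻-late ex ¬ey = sortByKey-≻ (key-early-late ex ¬ey)

  early-≻ : ∀ {x y} → x < y → E x → x ≻[ earlyFirst ] y
  early-≻ x<y ex = sortByKey-≻ (key-mono x<y λ (_ , ¬ex) → ¬ex ex)

  ≻-late : ∀ {x y} → x < y → ¬ E y → x ≻[ earlyFirst ] y
  ≻-late x<y ¬ey = sortByKey-≻ (key-mono x<y λ (ey , _) → ¬ey ey)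

  inversion : ∀ {x y} → x < y → y ≻[ earlyFirst ] x → E y × ¬ E x
  inversion {x} {y} x<y y≻x = classify (E? x) (E? y)
    where
    classify : Dec (E x) → Dec (E y) → E y × ¬ E x
    classify (yes ex) _ = ⊥-elim (≻-asym earlyFirst y≻x (early-≻ x<y ex))
    classify (no _) (no ¬ey) = ⊥-elim (≻-asym earlyFirst y≻x (≻-late x<y ¬ey))
    classify (no ¬ex) (yes ey) = ey , ¬ex

-- Majority relations

votes-complement : ∀ {x y : Fin n} → x ≢ y → ∀ P → votes x y P + votes y x P ≡ length P
votes-complement x≢y [] = refl
votes-complement {x = x} {y} x≢y (v ∷ P) with ≻-total v x≢y
... | inj₁ x≻y rewrite prefB-≻ v x≻y | prefB-≺ v x≻y = cong ℕ.suc (votes-complement x≢y P)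
... | inj₂ y≻x rewrite prefB-≻ v y≻x | prefB-≺ v y≻x =
  trans (ℕₚ.+-suc (votes x y P) (votes y x P)) (cong ℕ.suc (votes-complement x≢y P))

votes-chain : ∀ {x y z : Fin n} → x ≢ y → y ≢ z → ∀ {P} → All (λ v → ¬ Chain v x y z) P →
              votes x y P + votes y z P ≤ length P
votes-chain x≢y y≢z [] = z≤n
votes-chain {x = x} {y} {z} x≢y y≢z {v ∷ P} (no-chain ∷ rest)
  with ≻-total v x≢y | ≻-total v y≢z
... | inj₁ x≻y | inj₁ y≻z = ⊥-elim (no-chain (x≻y , y≻z))
... | inj₁ x≻y | inj₂ z≻y rewrite prefB-≻ v x≻y | prefB-≺ v z≻y =
  s≤s (votes-chain x≢y y≢z rest)
... | inj₂ y≻x | inj₁ y≻z rewrite prefB-≺ v y≻x | prefB-≻ v y≻z | ℕₚ.+-suc (votes x y P) (votes y z P) =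
  s≤s (votes-chain x≢y y≢z rest)
... | inj₂ y≻x | inj₂ z≻y rewrite prefB-≺ v y≻x | prefB-≺ v z≻y =
  ℕₚ.m≤n⇒m≤1+n (votes-chain x≢y y≢z rest)

-- Each of the two majorities is supported by more than half of the voters, and no voter
-- supports both.
no-majority-chain : ∀ {x y z : Fin n} {P} → x ≢ y → y ≢ z → All (λ v → ¬ Chain v x y z) P →
                    Maj P x y → Maj P y z → ⊥
no-majority-chain {x = x} {y} {z} {P} x≢y y≢z never x>y y>z = ℕₚ.<-irrefl refl q<q
  where
  open ℕₚ.≤-Reasoning
  p p′ q q′ : ℕ
  p = votes x y P
  p′ = votes y x P
  q = votes y z P
  q′ = votes z y P
  q≤p′ : q ≤ p′
  q≤p′ = ℕₚ.+-cancelˡ-≤ p q p′ (begin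
    p + q     ≤⟨ votes-chain x≢y y≢z never ⟩
    length P  ≡⟨ votes-complement x≢y P ⟨
    p + p′    ∎)
  p≤q′ : p ≤ q′
  p≤q′ = ℕₚ.+-cancelˡ-≤ q p q′ (begin
    q + p     ≡⟨ ℕₚ.+-comm q p ⟩
    p + q     ≤⟨ votes-chain x≢y y≢z never ⟩
    length P  ≡⟨ votes-complement y≢z P ⟨
    q + q′    ∎)
  q<q : q ℕ.< q
  q<q = begin-strict q ≤⟨ q≤p′ ⟩ p′ <⟨ x>y ⟩ p ≤⟨ p≤q′ ⟩ q′ <⟨ y>z ⟩ q ∎

maj-irrefl : ∀ {x : Fin n} P → ¬ Maj P x x
maj-irrefl P = ℕₚ.<-irrefl refl

maj-asym : ∀ {x y : Fin n} P → Maj P x y → ¬ Maj P y x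
maj-asym P = ℕₚ.<-asym

maj-total : ∀ {x y : Fin n} P → Odd (length P) → x ≢ y → Maj P x y ⊎ Maj P y x
maj-total {x = x} {y} P (k , odd) x≢y with ℕₚ.<-cmp (votes y x P) (votes x y P)
... | tri< x>y _ _ = inj₁ x>y
... | tri> _ _ y>x = inj₂ y>x
... | tri≈ _ tie _ = ⊥-elim (ℕₚ.even≢odd (votes x y P) k (begin
  2 * votes x y P             ≡⟨ cong (votes x y P +_) (ℕₚ.+-identityʳ _) ⟩
  votes x y P + votes x y P   ≡⟨ cong (votes x y P +_) tie ⟨
  votes x y P + votes y x P   ≡⟨ votes-complement x≢y P ⟩
  length P                    ≡⟨ odd ⟩
  ℕ.suc (2 * k)               ∎))
  where open ≡-Reasoning

Cyclic : (Fin n → Fin n → Set) → Fin n → Fin n → Fin n → Set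
Cyclic R x y z = R x y × R y z × R z x

rotate : ∀ (R : Fin n → Fin n → Set) {x y z} → Cyclic R x y z → Cyclic R y z x
rotate R (rxy , ryz , rzx) = ryz , rzx , rxy

acyclic-if-sorted-acyclic :
  ∀ {R : Fin n → Fin n → Set} → (∀ {x} → ¬ R x x) →
  (∀ {a b c} → a < b → b < c → ¬ Cyclic R a b c × ¬ Cyclic R a c b) →
  ∀ {x y z} → ¬ Cyclic R x y z
acyclic-if-sorted-acyclic {R = R} irrefl sorted {x} {y} {z} cyc
  with Finₚ.<-cmp x y | Finₚ.<-cmp y z | Finₚ.<-cmp x z
... | tri≈ _ refl _ | _ | _ = irrefl (proj₁ cyc)
... | _ | tri≈ _ refl _ | _ = irrefl (proj₁ (rotate R cyc))
... | _ | _ | tri≈ _ refl _ = irrefl (proj₁ (rotate R (rotate R cyc)))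
... | tri< x<y _ _ | tri< y<z _ _ | _ = proj₁ (sorted x<y y<z) cyc
... | tri< x<y _ _ | tri> _ _ z<y | tri< x<z _ _ = proj₂ (sorted x<z z<y) cyc
... | tri< x<y _ _ | tri> _ _ z<y | tri> _ _ z<x = proj₁ (sorted z<x x<y) (rotate R (rotate R cyc))
... | tri> _ _ y<x | tri< y<z _ _ | tri< x<z _ _ = proj₂ (sorted y<x x<z) (rotate R cyc)
... | tri> _ _ y<x | tri< y<z _ _ | tri> _ _ z<x = proj₁ (sorted y<z z<x) (rotate R cyc)
... | tri> _ _ y<x | tri> _ _ z<y | _ = proj₂ (sorted z<y y<x) (rotate R (rotate R cyc))

condorcet-if-no-sorted-cycle :
  ∀ {D : Domain n} →
  (∀ P → All D P → ∀ {a b c} → a < b → b < c → ¬ Cyclic (Maj P) a b c × ¬ Cyclic (Maj P) a c b) →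
  IsCondorcet D
condorcet-if-no-sorted-cycle no-cycle P odd P⊆D x y z x>y y>z
  with maj-total P odd (λ { refl → maj-asym P x>y y>z })
... | inj₁ x>z = x>z
... | inj₂ z>x = ⊥-elim (acyclic-if-sorted-acyclic (maj-irrefl P) (no-cycle P P⊆D) (x>y , y>z , z>x))

module _ (u v w : LinOrd n) (x y : Fin n) where

  maj-except-first : y ≻[ u ] x → x ≻[ v ] y → x ≻[ w ] y → Maj (u ∷ v ∷ w ∷ []) x y
  maj-except-first p q r
    rewrite prefB-≻ u p | prefB-≺ u p | prefB-≻ v q | prefB-≺ v q | prefB-≻ w r | prefB-≺ w r =
    s≤s (s≤s z≤n)

  maj-except-second : x ≻[ u ] y → y ≻[ v ] x → x ≻[ w ] y → Maj (u ∷ v ∷ w ∷ []) x y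
  maj-except-second p q r
    rewrite prefB-≻ u p | prefB-≺ u p | prefB-≻ v q | prefB-≺ v q | prefB-≻ w r | prefB-≺ w r =
    s≤s (s≤s z≤n)

  maj-except-third : x ≻[ u ] y → x ≻[ v ] y → y ≻[ w ] x → Maj (u ∷ v ∷ w ∷ []) x y
  maj-except-third p q r
    rewrite prefB-≻ u p | prefB-≺ u p | prefB-≻ v q | prefB-≺ v q | prefB-≻ w r | prefB-≺ w r =
    s≤s (s≤s z≤n)

Realised : Domain n → Fin n → Fin n → Fin n → Set
Realised D x y z = ∃[ v ] D v × Chain v x y z

latin-square : ∀ {D : Domain n} {x y z} → IsCondorcet D →
               Realised D x y z → Realised D y z x → Realised D z x y → ⊥
latin-square {x = x} {y} {z} condorcet
  (u , u∈D , x≻y , y≻z) (v , v∈D , y≻z′ , z≻x) (w , w∈D , z≻x′ , x≻y′) =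
  maj-asym P (condorcet P (1 , refl) (u∈D ∷ v∈D ∷ w∈D ∷ []) x y z x>y y>z) z>x
  where
  P : Profile _
  P = u ∷ v ∷ w ∷ []
  x>y : Maj P x y
  x>y = maj-except-second u v w x y x≻y (≻-trans v y≻z′ z≻x) x≻y′
  y>z : Maj P y z
  y>z = maj-except-third u v w y z y≻z y≻z′ (≻-trans w z≻x′ x≻y′)
  z>x : Maj P z x
  z>x = maj-except-first u v w z x (≻-trans u x≻y y≻z) z≻x z≻x′

-- The six orders of a triple

data Shape : Set where
  abc acb bac bca cab cba : Shape

Ranks : LinOrd n → Fin n → Fin n → Fin n → Shape → Set
Ranks v a b c abc = Chain v a b c
Ranks v a b c acb = Chain v a c b
Ranks v a b c bac = Chain v b a c
Ranks v a b c bca = Chain v b c a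
Ranks v a b c cab = Chain v c a b
Ranks v a b c cba = Chain v c b a

code : Shape → Restr
code abc = true , true , true
code acb = true , true , false
code bac = false , true , true
code bca = false , false , true
code cab = true , false , false
code cba = false , false , false

restrict-≡ : ∀ (v : LinOrd n) a b c {r₁ r₂ r₃} →
             prefB v a b ≡ r₁ → prefB v a c ≡ r₂ → prefB v b c ≡ r₃ → restrict v a b c ≡ (r₁ , r₂ , r₃)
restrict-≡ _ _ _ _ refl refl refl = refl

restrict-Ranks : ∀ (v : LinOrd n) a b c s → Ranks v a b c s → restrict v a b c ≡ code s
restrict-Ranks v a b c abc (a≻b , b≻c) =
  restrict-≡ v a b c (prefB-≻ v a≻b) (prefB-≻ v (≻-trans v a≻b b≻c)) (prefB-≻ v b≻c)
restrict-Ranks v a b c acb (a≻c , c≻b) =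
  restrict-≡ v a b c (prefB-≻ v (≻-trans v a≻c c≻b)) (prefB-≻ v a≻c) (prefB-≺ v c≻b)
restrict-Ranks v a b c bac (b≻a , a≻c) =
  restrict-≡ v a b c (prefB-≺ v b≻a) (prefB-≻ v a≻c) (prefB-≻ v (≻-trans v b≻a a≻c))
restrict-Ranks v a b c bca (b≻c , c≻a) =
  restrict-≡ v a b c (prefB-≺ v (≻-trans v b≻c c≻a)) (prefB-≺ v c≻a) (prefB-≻ v b≻c)
restrict-Ranks v a b c cab (c≻a , a≻b) =
  restrict-≡ v a b c (prefB-≻ v a≻b) (prefB-≺ v c≻a) (prefB-≺ v (≻-trans v c≻a a≻b))
restrict-Ranks v a b c cba (c≻b , b≻a) =
  restrict-≡ v a b c (prefB-≺ v b≻a) (prefB-≺ v (≻-trans v c≻b b≻a)) (prefB-≺ v c≻b)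

shapeOf : (v : LinOrd n) → ∀ {a b c} → a < b → b < c → Σ Shape (Ranks v a b c)
shapeOf v a<b b<c
  with ≻-total v (<⇒≢ a<b) | ≻-total v (<⇒≢ (Finₚ.<-trans a<b b<c)) | ≻-total v (<⇒≢ b<c)
... | inj₁ a≻b | _        | inj₁ b≻c = abc , a≻b , b≻c
... | _        | inj₁ a≻c | inj₂ c≻b = acb , a≻c , c≻b
... | inj₂ b≻a | inj₁ a≻c | _        = bac , b≻a , a≻c
... | _        | inj₂ c≻a | inj₁ b≻c = bca , b≻c , c≻a
... | inj₁ a≻b | inj₂ c≻a | _        = cab , c≻a , a≻b
... | inj₂ b≻a | _        | inj₂ c≻b = cba , c≻b , b≻a

Admissible : Subset n → Fin n → Shape → Set
Admissible A b abc = ⊤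
Admissible A b acb = ⊤
Admissible A b bac = ⊤
Admissible A b bca = b ∉ A
Admissible A b cab = b ∈ A
Admissible A b cba = ⊥

-- The set-alternating domain

module _ (A : Subset n) where

  AllShapesAdmissible : LinOrd n → Set
  AllShapesAdmissible v = ∀ {a b c} → a < b → b < c → ∀ s → Ranks v a b c s → Admissible A b s

  setAlt⇒admissible : ∀ {v} → SetAltDomain A v → AllShapesAdmissible v
  setAlt⇒admissible {v} v∈D {a} {b} {c} a<b b<c = admissible
    where
    never-a-last : b ∈ A → ¬ (b ≻[ v ] a × c ≻[ v ] a)
    never-a-last = proj₁ (v∈D a b c a<b b<c)
    never-c-first : b ∉ A → ¬ (c ≻[ v ] a × c ≻[ v ] b)
    never-c-first = proj₂ (v∈D a b c a<b b<c)
    admissible : ∀ s → Ranks v a b c s → Admissible A b s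
    admissible abc _ = tt
    admissible acb _ = tt
    admissible bac _ = tt
    admissible bca (b≻c , c≻a) b∈A = never-a-last b∈A (≻-trans v b≻c c≻a , c≻a)
    admissible cab (c≻a , a≻b) with b ∈? A
    ... | yes b∈A = b∈A
    ... | no b∉A = ⊥-elim (never-c-first b∉A (c≻a , ≻-trans v c≻a a≻b))
    admissible cba (c≻b , b≻a) with b ∈? A
    ... | yes b∈A = never-a-last b∈A (b≻a , ≻-trans v c≻b b≻a)
    ... | no b∉A = never-c-first b∉A (≻-trans v c≻b b≻a , c≻b)

  admissible⇒setAlt : ∀ {v} → AllShapesAdmissible v → SetAltDomain A v
  admissible⇒setAlt {v} admissible i j k i<j j<k = never-i-last , never-k-first
    where
    never-i-last : j ∈ A → ¬ (j ≻[ v ] i × k ≻[ v ] i)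
    never-i-last j∈A (j≻i , k≻i) with ≻-total v (<⇒≢ j<k)
    ... | inj₁ j≻k = admissible i<j j<k bca (j≻k , k≻i) j∈A
    ... | inj₂ k≻j = admissible i<j j<k cba (k≻j , j≻i)
    never-k-first : j ∉ A → ¬ (k ≻[ v ] i × k ≻[ v ] j)
    never-k-first j∉A (k≻i , k≻j) with ≻-total v (<⇒≢ i<j)
    ... | inj₁ i≻j = j∉A (admissible i<j j<k cab (k≻i , i≻j))
    ... | inj₂ j≻i = admissible i<j j<k cba (k≻j , j≻i)

  Compatible : (Fin n → Set) → Set
  Compatible E = ∀ {i j k} → i < j → j < k → ¬ E i → E k → (j ∈ A → ¬ E j) × (j ∉ A → E j)

  earlyFirst-∈ : ∀ {E} (E? : Decidable E) → Compatible E → SetAltDomain A (EarlyFirst.earlyFirst E?)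
  earlyFirst-∈ E? compatible i j k i<j j<k = never-i-last , never-k-first
    where
    open EarlyFirst E?
    i<k : i < k
    i<k = ℕₚ.<-trans i<j j<k
    never-i-last : j ∈ A → ¬ (j ≻[ earlyFirst ] i × k ≻[ earlyFirst ] i)
    never-i-last j∈A (j≻i , k≻i) =
      let (k-early , i-late) = inversion i<k k≻i
      in proj₁ (compatible i<j j<k i-late k-early) j∈A (proj₁ (inversion i<j j≻i))
    never-k-first : j ∉ A → ¬ (k ≻[ earlyFirst ] i × k ≻[ earlyFirst ] j)
    never-k-first j∉A (k≻i , k≻j) =
      let (k-early , i-late) = inversion i<k k≻i
      in proj₂ (inversion j<k k≻j) (proj₂ (compatible i<j j<k i-late k-early) j∉A)

  Early : Fin n → Fin n → Fin n → Set
  Early a b x = x < a ⊎ (a < x × x < b) × x ∉ A ⊎ x ≡ b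

  early? : ∀ a b → Decidable (Early a b)
  early? a b x = x Finₚ.<? a ⊎-dec ((a Finₚ.<? x ×-dec x Finₚ.<? b) ×-dec ¬? (x ∈? A)) ⊎-dec x Finₚ.≟ b

  not-early : ∀ {a b x} → ¬ x < a → ¬ ((a < x × x < b) × x ∉ A) → x ≢ b → ¬ Early a b x
  not-early x≮a _ _ (inj₁ x<a) = x≮a x<a
  not-early _ not-middle _ (inj₂ (inj₁ middle)) = not-middle middle
  not-early _ _ x≢b (inj₂ (inj₂ x≡b)) = x≢b x≡b

  lower-late : ∀ {a b} → a < b → ¬ Early a b a
  lower-late a<b = not-early (ℕₚ.<-irrefl refl) (λ ((a<a , _) , _) → ℕₚ.<-irrefl refl a<a) (<⇒≢ a<b)

  upper-late : ∀ {a b x} → a < b → b < x → ¬ Early a b x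
  upper-late a<b b<x =
    not-early (ℕₚ.<-asym (ℕₚ.<-trans a<b b<x)) (λ ((_ , x<b) , _) → ℕₚ.<-asym x<b b<x) (>⇒≢ b<x)

  member-late : ∀ {a b x} → a < x → x < b → x ∈ A → ¬ Early a b x
  member-late a<x x<b x∈A = not-early (ℕₚ.<-asym a<x) (λ (_ , x∉A) → x∉A x∈A) (<⇒≢ x<b)

  pivot-early : ∀ {a b} → Early a b b
  pivot-early = inj₂ (inj₂ refl)

  early-compatible : ∀ {a b} → Compatible (Early a b)
  early-compatible {a} {b} {i} {j} {k} i<j j<k i-late k-early =
    (λ j∈A → member-late a<j j<b j∈A) , (λ j∉A → inj₂ (inj₁ ((a<j , j<b) , j∉A)))
    where
    a<j : a < j
    a<j = ℕₚ.≤-<-trans (ℕₚ.≮⇒≥ (λ i<a → i-late (inj₁ i<a))) i<j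
    k≤b : Early a b k → toℕ k ≤ toℕ b
    k≤b (inj₁ k<a) = ⊥-elim (ℕₚ.<-asym k<a (ℕₚ.<-trans a<j j<k))
    k≤b (inj₂ (inj₁ ((_ , k<b) , _))) = ℕₚ.<⇒≤ k<b
    k≤b (inj₂ (inj₂ refl)) = ℕₚ.≤-refl
    j<b : j < b
    j<b = ℕₚ.<-≤-trans j<k (k≤b k-early)

  module Order (a b : Fin n) = EarlyFirst (early? a b)

  order-∈ : ∀ a b → SetAltDomain A (Order.earlyFirst a b)
  order-∈ a b = earlyFirst-∈ (early? a b) early-compatible

  axis-∈ : SetAltDomain A id
  axis-∈ i j k i<j j<k = (λ _ (j<i , _) → ℕₚ.<-asym i<j j<i) ,
                         (λ _ (k<i , _) → ℕₚ.<-asym (ℕₚ.<-trans i<j j<k) k<i)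

  realise : ∀ {a b c} → a < b → b < c → ∀ s → Admissible A b s → ∃[ v ] SetAltDomain A v × Ranks v a b c s
  realise a<b b<c abc _ = id , axis-∈ , a<b , b<c
  realise {a} {b} {c} a<b b<c acb _ =
    Order.earlyFirst b c , order-∈ b c ,
    Order.early-≻ b c (ℕₚ.<-trans a<b b<c) (inj₁ a<b) ,
    Order.early-≻-late b c pivot-early (lower-late b<c)
  realise {a} {b} {c} a<b b<c bac _ =
    Order.earlyFirst a b , order-∈ a b ,
    Order.early-≻-late a b pivot-early (lower-late a<b) ,
    Order.≻-late a b (ℕₚ.<-trans a<b b<c) (upper-late a<b b<c)
  realise {a} {b} {c} a<b b<c bca b∉A =
    Order.earlyFirst a c , order-∈ a c ,
    Order.early-≻ a c b<c (inj₂ (inj₁ ((a<b , b<c) , b∉A))) ,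
    Order.early-≻-late a c pivot-early (lower-late (ℕₚ.<-trans a<b b<c))
  realise {a} {b} {c} a<b b<c cab b∈A =
    Order.earlyFirst a c , order-∈ a c ,
    Order.early-≻-late a c pivot-early (lower-late (ℕₚ.<-trans a<b b<c)) ,
    Order.≻-late a c a<b (member-late a<b b<c b∈A)

  inadmissible-absent : ∀ {P} → All (SetAltDomain A) P → ∀ {a b c} → a < b → b < c →
                        ∀ s → ¬ Admissible A b s → All (λ v → ¬ Ranks v a b c s) P
  inadmissible-absent P⊆D a<b b<c s inadmissible =
    All.map (λ v∈D ranks → inadmissible (setAlt⇒admissible v∈D a<b b<c s ranks)) P⊆D

  setAlt-condorcet : IsCondorcet (SetAltDomain A)
  setAlt-condorcet = condorcet-if-no-sorted-cycle no-cycle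
    where
    no-cycle : ∀ P → All (SetAltDomain A) P → ∀ {a b c} → a < b → b < c →
               ¬ Cyclic (Maj P) a b c × ¬ Cyclic (Maj P) a c b
    no-cycle P P⊆D {a} {b} {c} a<b b<c = no-abc , no-acb
      where
      absent : ∀ s → ¬ Admissible A b s → All (λ v → ¬ Ranks v a b c s) P
      absent = inadmissible-absent P⊆D a<b b<c
      a<c : a < c
      a<c = ℕₚ.<-trans a<b b<c
      no-abc : ¬ Cyclic (Maj P) a b c
      no-abc (a>b , b>c , c>a) with b ∈? A
      ... | yes b∈A = no-majority-chain (<⇒≢ b<c) (>⇒≢ a<c) (absent bca λ b∉A → b∉A b∈A) b>c c>a
      ... | no b∉A = no-majority-chain (>⇒≢ a<c) (<⇒≢ a<b) (absent cab b∉A) c>a a>b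
      no-acb : ¬ Cyclic (Maj P) a c b
      no-acb (_ , c>b , b>a) = no-majority-chain (>⇒≢ b<c) (>⇒≢ a<b) (absent cba λ ()) c>b b>a

  extension-admissible : ∀ {D′ : Domain n} → IsCondorcet D′ → (∀ v → SetAltDomain A v → D′ v) →
                         ∀ {v} → D′ v → AllShapesAdmissible v
  extension-admissible {D′} condorcet D⊆D′ {v} v∈D′ {a} {b} {c} a<b b<c = admissible
    where
    realised : ∀ s → Admissible A b s → ∃[ u ] D′ u × Ranks u a b c s
    realised s adm = let (u , u∈D , ranks) = realise a<b b<c s adm in u , D⊆D′ u u∈D , ranks
    given : ∀ s → Ranks v a b c s → ∃[ u ] D′ u × Ranks u a b c s
    given s ranks = v , v∈D′ , ranks
    admissible : ∀ s → Ranks v a b c s → Admissible A b s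
    admissible abc _ = tt
    admissible acb _ = tt
    admissible bac _ = tt
    admissible bca ranks with b ∈? A
    ... | no b∉A = b∉A
    ... | yes b∈A = λ _ → latin-square condorcet (realised abc tt) (given bca ranks) (realised cab b∈A)
    admissible cab ranks with b ∈? A
    ... | yes b∈A = b∈A
    ... | no b∉A = ⊥-elim (latin-square condorcet (realised abc tt) (realised bca b∉A) (given cab ranks))
    admissible cba ranks = latin-square condorcet (realised acb tt) (given cba ranks) (realised bac tt)

  setAlt-maximal : IsMaximalCondorcet (SetAltDomain A)
  setAlt-maximal = setAlt-condorcet , λ D′ condorcet D⊆D′ v v∈D′ →
    admissible⇒setAlt (extension-admissible condorcet D⊆D′ v∈D′)

  setAlt-peakPit : PeakPit (SetAltDomain A)
  setAlt-peakPit a b c a<b b<c with b ∈? A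
  ... | yes b∈A = inj₁ (a , inj₁ refl , λ v v∈D a-last → proj₁ (v∈D a b c a<b b<c) b∈A
        (a-last b (inj₂ (inj₁ refl)) (>⇒≢ a<b) , a-last c (inj₂ (inj₂ refl)) (>⇒≢ (ℕₚ.<-trans a<b b<c))))
  ... | no b∉A = inj₂ (c , inj₂ (inj₂ refl) , λ v v∈D c-first → proj₂ (v∈D a b c a<b b<c) b∉A
        (c-first a (inj₁ refl) (<⇒≢ (ℕₚ.<-trans a<b b<c)) , c-first b (inj₂ (inj₁ refl)) (<⇒≢ b<c)))

  admissibleShapes : ∀ {b} → Dec (b ∈ A) → List Shape
  admissibleShapes (yes _) = abc ∷ acb ∷ bac ∷ cab ∷ []
  admissibleShapes (no _) = abc ∷ acb ∷ bac ∷ bca ∷ []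

  admissible⇒∈ : ∀ {b} (d : Dec (b ∈ A)) s → Admissible A b s → s ∈ₗ admissibleShapes d
  admissible⇒∈ (yes _) abc _ = here refl
  admissible⇒∈ (yes _) acb _ = there (here refl)
  admissible⇒∈ (yes _) bac _ = there (there (here refl))
  admissible⇒∈ (yes _) cab _ = there (there (there (here refl)))
  admissible⇒∈ (yes b∈A) bca b∉A = ⊥-elim (b∉A b∈A)
  admissible⇒∈ (no _) abc _ = here refl
  admissible⇒∈ (no _) acb _ = there (here refl)
  admissible⇒∈ (no _) bac _ = there (there (here refl))
  admissible⇒∈ (no _) bca _ = there (there (there (here refl)))
  admissible⇒∈ (no b∉A) cab b∈A = ⊥-elim (b∉A b∈A)

  ∈⇒admissible : ∀ {b} (d : Dec (b ∈ A)) {s} → s ∈ₗ admissibleShapes d → Admissible A b s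
  ∈⇒admissible (yes _) (here refl) = tt
  ∈⇒admissible (yes _) (there (here refl)) = tt
  ∈⇒admissible (yes _) (there (there (here refl))) = tt
  ∈⇒admissible (yes b∈A) (there (there (there (here refl)))) = b∈A
  ∈⇒admissible (no _) (here refl) = tt
  ∈⇒admissible (no _) (there (here refl)) = tt
  ∈⇒admissible (no _) (there (there (here refl))) = tt
  ∈⇒admissible (no b∉A) (there (there (there (here refl)))) = b∉A

  codes-length : ∀ {b} (d : Dec (b ∈ A)) → length (map code (admissibleShapes d)) ≡ 4
  codes-length (yes _) = refl
  codes-length (no _) = refl

  codes-unique : ∀ {b} (d : Dec (b ∈ A)) → Unique (map code (admissibleShapes d))
  codes-unique (yes _) = ((λ ()) ∷ (λ ()) ∷ (λ ()) ∷ []) ∷ ((λ ()) ∷ (λ ()) ∷ []) ∷ ((λ ()) ∷ []) ∷ [] ∷ []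
  codes-unique (no _) = ((λ ()) ∷ (λ ()) ∷ (λ ()) ∷ []) ∷ ((λ ()) ∷ (λ ()) ∷ []) ∷ ((λ ()) ∷ []) ∷ [] ∷ []

  setAlt-copious : Copious (SetAltDomain A)
  setAlt-copious a b c a<b b<c =
    map code shapes , codes-length (b ∈? A) , codes-unique (b ∈? A) , map⁺ (All.tabulate realised) , covered
    where
    shapes : List Shape
    shapes = admissibleShapes (b ∈? A)
    realised : ∀ {s} → s ∈ₗ shapes → ∃[ v ] SetAltDomain A v × restrict v a b c ≡ code s
    realised {s} s∈ =
      let (v , v∈D , ranks) = realise a<b b<c s (∈⇒admissible (b ∈? A) s∈)
      in v , v∈D , restrict-Ranks v a b c s ranks
    covered : ∀ v → SetAltDomain A v → restrict v a b c ∈ₗ map code shapes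
    covered v v∈D =
      let (s , ranks) = shapeOf v a<b b<c
      in subst (_∈ₗ map code shapes) (sym (restrict-Ranks v a b c s ranks))
               (∈-map⁺ code (admissible⇒∈ (b ∈? A) s (setAlt⇒admissible v∈D a<b b<c s ranks)))

-- The argument works for every n.
mainTheorem2 : ∀ (n : ℕ) → 1 ≤ n → (A : Subset n) →
    Copious (SetAltDomain A) × PeakPit (SetAltDomain A) × IsMaximalCondorcet (SetAltDomain A)
mainTheorem2 n _ A = setAlt-copious A , setAlt-peakPit A , setAlt-maximal A
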